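{- Let $\mathcal{M}$ be a finite monoid with product $\star$ and unit $1_\mathcal{M}$. For $x\in\mathcal{M}$ and a word $w=w_1\cdots w_\ell\in\mathcal{M}^*$ set $x*w:=(x\star w_1)\cdots(x\star w_\ell)$, extended linearly to $\mathbb{K}\langle\mathcal{M}^*\rangle$. Then $\mathbb{K}\langle\mathcal{M}^*\rangle$ is an $\mathrm{NC}\mathcal{M}$-algebra in which each $\mathcal{M}$-triangle $\mathfrak{p}$ (base label $\mathfrak{p}_0$, first edge label $\mathfrak{p}_1$, second edge label $\mathfrak{p}_2$) acts by the binary operation $f_1\otimes f_2\mapsto\mathfrak{p}_0*\big((\mathfrak{p}_1*f_1)(\mathfrak{p}_2*f_2)\big)$, where juxtaposition is the concatenation product of noncommutative polynomials.
   Context: $\mathbb{K}$ is a field of characteristic zero; $\mathbb{K}\langle\mathcal{M}^*\rangle$ is the space of noncommutative polynomials over the alphabet $\mathcal{M}$. A monoid is in particular a unitary magma. For $n\ge1$, an $\mathcal{M}$-clique of arity $n$ labels each arc $(x,y)$, $1\le x<y\le n+1$, of a polygon with vertices $1,\dots,n+1$ by an element of $\mathcal{M}$; base $(1,n+1)$ with label $\mathfrak{p}_0$, edges $(i,i+1)$ with labels $\mathfrak{p}_i$; a unique clique in arity 1. Solid arc: label $\neq1_\mathcal{M}$; noncrossing: no two solid diagonals $(x,y),(x',y')$ with $x<x'<y<y'$ or $x'<x<y'<y$. $\mathfrak{p}\circ_i\mathfrak{q}$ ($\mathfrak{q}$ of arity $m$) glues the base of $\mathfrak{q}$ onto the $i$th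 edge of $\mathfrak{p}$, arcs keep labels (vertices of $\mathfrak{p}$ greater than $i$ shifted by $m-1$, vertices of $\mathfrak{q}$ shifted by $i-1$), the common arc $(i,i+m)$ gets $\mathfrak{p}_i\star\mathfrak{q}_0$, others $1_\mathcal{M}$. $\mathrm{NC}\mathcal{M}$ is the operad spanned by noncrossing cliques; it is generated by the $\mathcal{M}$-triangles (arity 2). An $\mathrm{NC}\mathcal{M}$-algebra is a vector space with a linear action of $\mathrm{NC}\mathcal{M}$ compatible with partial compositions. -}

module Defs where

open import Level using (Level; _⊔_) renaming (suc to lsuc)
open import Data.Nat using (ℕ; zero; suc; _+_; _∸_; _≤_; _<_; _≤ᵇ_; _≡ᵇ_)
open import Data.Bool using (Bool; true; false; if_then_else_; _∧_; _∨_)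
open import Data.Fin using (Fin)
open import Data.Product using (_×_; _,_; Σ; proj₁; proj₂)
open import Data.List using (List; []; _∷_; map; _++_; concatMap)
open import Data.Vec using (Vec; []; _∷_) renaming (_++_ to _++ᵥ_)
open import Data.Empty using (⊥)
open import Relation.Nullary using (¬_; yes; no)
open import Relation.Binary.PropositionalEquality using (_≡_; _≢_; refl; cong; sym; trans)
open import Relation.Binary.Definitions using (DecidableEquality)
open import Algebra.Bundles using (CommutativeRing)
open import Algebra.Structures using (IsMonoid)
open import Function.Bundles using (_↔_; Inverse)
import Data.Fin.Properties as FinP
import Data.List.Properties as ListP

record Field (c ℓ : Level) : Set (lsuc (c ⊔ ℓ)) where
  field
    commutativeRing : CommutativeRing c ℓ
  open CommutativeRing commutativeRing public
  field
    0≉1     : ¬ (0# ≈ 1#)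
    inverse : ∀ x → ¬ (x ≈ 0#) → Σ Carrier (λ y → (x * y) ≈ 1#)

natCast : ∀ {c ℓ} (K : Field c ℓ) → ℕ → Field.Carrier K
natCast K zero    = Field.0# K
natCast K (suc n) = Field._+_ K (Field.1# K) (natCast K n)

CharacteristicZero : ∀ {c ℓ} → Field c ℓ → Set ℓ
CharacteristicZero K = ∀ n → Field._≈_ K (natCast K (suc n)) (Field.0# K) → ⊥

record FiniteMonoid (a : Level) : Set (lsuc a) where
  infixl 7 _⋆_
  field
    Carrier  : Set a
    _⋆_      : Carrier → Carrier → Carrier
    𝟙        : Carrier
    isMonoid : IsMonoid _≡_ _⋆_ 𝟙
    size     : ℕ
    enum     : Carrier ↔ Fin size

  _≟_ : DecidableEquality Carrier
  x ≟ y with FinP._≟_ (Inverse.to enum x) (Inverse.to enum y)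
  ... | yes p = yes (trans (sym (Inverse.strictlyInverseʳ enum x)) (trans (cong (Inverse.from enum) p) (Inverse.strictlyInverseʳ enum y)))
  ... | no ¬p = no (λ e → ¬p (cong (Inverse.to enum) e))

-- Cliques.  A clique is given by its labelling function on pairs of
-- vertices (x , y); for a clique of arity n only the arcs
-- 1 ≤ x < y ≤ n + 1 are meaningful.

module Cliques {a : Level} (M : FiniteMonoid a) where
  open FiniteMonoid M

  Clique : Set a
  Clique = ℕ → ℕ → Carrier

  ValidArc : ℕ → ℕ → ℕ → Set
  ValidArc n x y = (1 ≤ x) × (x < y) × (y ≤ suc n)

  _≋[_]_ : Clique → ℕ → Clique → Set a
  p ≋[ n ] q = ∀ x y → ValidArc n x y → p x y ≡ q x y

  Solid : Clique → ℕ → ℕ → Set a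
  Solid p x y = p x y ≢ 𝟙

  -- no two solid arcs (x,y),(x',y') with x < x' < y < y'
  -- (such arcs are necessarily diagonals; the symmetric case is
  --  covered by exchanging the roles of the two arcs)
  NonCrossing : ℕ → Clique → Set a
  NonCrossing n p = ∀ x y x' y' → ValidArc n x y → ValidArc n x' y' →
    Solid p x y → Solid p x' y' → x < x' → x' < y → y < y' → ⊥

  -- p is a (basis element) noncrossing M-clique of arity n; arity ≥ 1
  -- and the arity-1 clique is unique (its only arc carries 𝟙).
  IsNCClique : ℕ → Clique → Set a
  IsNCClique n p = (1 ≤ n) × (n ≡ 1 → p 1 2 ≡ 𝟙) × NonCrossing n p

  -- Partial composition p ∘_(i+1) q, q of arity m: the base of q is glued
  -- onto the (i+1)-th edge (i+1 , i+2) of p.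
  compose : (i m : ℕ) → Clique → Clique → Clique
  compose i m p q x y =
    if (x ≡ᵇ I) ∧ (y ≡ᵇ (I + m)) then p I (suc I) ⋆ q 1 (suc m)
    else if (I ≤ᵇ x) ∧ (y ≤ᵇ (I + m)) then q (x ∸ i) (y ∸ i)
    else if inP x ∧ inP y then p (un x) (un y)
    else 𝟙
    where
    I : ℕ
    I = suc i
    -- vertices of the result coming from vertices of p
    inP : ℕ → Bool
    inP v = (v ≤ᵇ I) ∨ ((I + m) ≤ᵇ v)
    un : ℕ → ℕ
    un v = if v ≤ᵇ I then v else v ∸ (m ∸ 1)

  triangle : Carrier → Carrier → Carrier → Clique
  triangle p₀ p₁ p₂ x y =
    if (x ≡ᵇ 1) ∧ (y ≡ᵇ 3) then p₀
    else if (x ≡ᵇ 1) ∧ (y ≡ᵇ 2) then p₁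
    else if (x ≡ᵇ 2) ∧ (y ≡ᵇ 3) then p₂
    else 𝟙

-- Noncommutative polynomials K⟨M*⟩ as finite formal linear combinations
-- of words, compared through their coefficient functions.

module Polynomials {c ℓ a : Level} (K : Field c ℓ) (M : FiniteMonoid a) where
  open Field K using (Carrier; _≈_; 0#) renaming (_+_ to _+K_; _*_ to _*K_)
  open FiniteMonoid M using (_⋆_) renaming (Carrier to Mon; _≟_ to _≟M_)

  Word : Set a
  Word = List Mon

  Poly : Set (c ⊔ a)
  Poly = List (Carrier × Word)

  coeff : Poly → Word → Carrier
  coeff []            w = 0#
  coeff ((k , u) ∷ f) w with ListP.≡-dec _≟M_ u w
  ... | yes _ = k +K coeff f w
  ... | no  _ = coeff f w

  infix 4 _≈ₚ_
  _≈ₚ_ : Poly → Poly → Set (ℓ ⊔ a)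
  f ≈ₚ g = ∀ w → coeff f w ≈ coeff g w

  _+ₚ_ : Poly → Poly → Poly
  f +ₚ g = f ++ g

  _•ₚ_ : Carrier → Poly → Poly
  k •ₚ f = map (λ t → (k *K proj₁ t , proj₂ t)) f

  _·ₚ_ : Poly → Poly → Poly
  f ·ₚ g = concatMap (λ t → map (λ s → (proj₁ t *K proj₁ s , proj₂ t ++ proj₂ s)) g) f

  actW : Mon → Word → Word
  actW x w = map (x ⋆_) w

  _*ₚ_ : Mon → Poly → Poly
  x *ₚ f = map (λ t → (proj₁ t , actW x (proj₂ t))) f

  triangleOp : Mon → Mon → Mon → Poly → Poly → Poly
  triangleOp p₀ p₁ p₂ f₁ f₂ = p₀ *ₚ ((p₁ *ₚ f₁) ·ₚ (p₂ *ₚ f₂))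

-- NC M-algebra structures on K⟨M*⟩: a linear action of NC M, given on
-- its basis of noncrossing cliques, by multilinear maps, compatible
-- with the unit and the partial compositions.

module NCAlgebra {c ℓ a : Level} (K : Field c ℓ) (M : FiniteMonoid a) where
  open Field K using (Carrier)
  open FiniteMonoid M renaming (Carrier to Mon)
  open Cliques M
  open Polynomials K M

  Action : Set (c ⊔ a)
  Action = (n : ℕ) (p : Clique) → IsNCClique n p → Vec Poly n → Poly

  record IsNCMAlgebra (act : Action) : Set (c ⊔ ℓ ⊔ a) where
    field
      -- the action depends only on the clique (not on the representation)
      act-cong-clique : ∀ n p q (hp : IsNCClique n p) (hq : IsNCClique n q) →
        p ≋[ n ] q → ∀ fs → act n p hp fs ≈ₚ act n q hq fs
      act-cong : ∀ i k p (hp : IsNCClique (i + suc k) p)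
        (xs : Vec Poly i) (zs : Vec Poly k) (f g : Poly) → f ≈ₚ g →
        act (i + suc k) p hp (xs ++ᵥ (f ∷ zs)) ≈ₚ act (i + suc k) p hp (xs ++ᵥ (g ∷ zs))
      act-additive : ∀ i k p (hp : IsNCClique (i + suc k) p)
        (xs : Vec Poly i) (zs : Vec Poly k) (f g : Poly) →
        act (i + suc k) p hp (xs ++ᵥ ((f +ₚ g) ∷ zs)) ≈ₚ
        (act (i + suc k) p hp (xs ++ᵥ (f ∷ zs)) +ₚ act (i + suc k) p hp (xs ++ᵥ (g ∷ zs)))
      act-homogeneous : ∀ i k p (hp : IsNCClique (i + suc k) p)
        (xs : Vec Poly i) (zs : Vec Poly k) (λ' : Carrier) (f : Poly) →
        act (i + suc k) p hp (xs ++ᵥ ((λ' •ₚ f) ∷ zs)) ≈ₚ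
        (λ' •ₚ act (i + suc k) p hp (xs ++ᵥ (f ∷ zs)))
      act-unit : ∀ p (hp : IsNCClique 1 p) (f : Poly) → act 1 p hp (f ∷ []) ≈ₚ f
      act-compose : ∀ i k m p q (hp : IsNCClique (i + suc k) p) (hq : IsNCClique m q)
        (hpq : IsNCClique (i + (m + k)) (compose i m p q))
        (xs : Vec Poly i) (ys : Vec Poly m) (zs : Vec Poly k) →
        act (i + (m + k)) (compose i m p q) hpq (xs ++ᵥ (ys ++ᵥ zs)) ≈ₚ
        act (i + suc k) p hp (xs ++ᵥ (act m q hq ys ∷ zs))

module Submission where

-- The action of a clique p of arity n sends f₁ ⊗ ⋯ ⊗ fₙ to (ω₁ * f₁) ⋯ (ωₙ * fₙ), where the
-- weight ωⱼ is the product of the labels of the arcs (x, y) with x ≤ j < y passing over the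
-- j-th edge, taken from the outside in (x increasing, then y decreasing).  As x * _ is a
-- monoid endomorphism for concatenation and x * (y * f) = (x ⋆ y) * f, a triangle acts by
-- p₀ * ((p₁ * f₁)(p₂ * f₂)).  In p ∘ᵢ q the arcs over an edge coming from q are those of p over
-- its i-th edge, then the glued arc labelled pᵢ ⋆ q₀, then those of q, so that edge has weight
-- ωᵢ(p) ⋆ ωⱼ(q), while the edges coming from p keep their weights: this is compatibility with
-- partial composition.  Identities of polynomials are checked
-- by evaluating both sides against an arbitrary linear functional on words.

open import Defs
open import Level using (Level; _⊔_)
open import Data.Product using (Σ; _×_; _,_; proj₁; proj₂)
open import Data.Vec using (Vec; []; _∷_) renaming (_++_ to _++ᵥ_)
open import Function using (_∘_; id)
open import Relation.Binary.PropositionalEquality as ≡ using (_≡_; _≢_)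
open import Relation.Binary.Structures using (IsEquivalence)
open import Algebra.Core using (Op₂)
open import Algebra.Structures using (IsMonoid)

module IntervalProduct {a} {A : Set a} {_∙_ : Op₂ A} {ε : A} (isMonoid : IsMonoid _≡_ _∙_ ε) where
  open IsMonoid isMonoid using (assoc; identityˡ; identityʳ)
  open import Data.Nat using (ℕ; zero; suc; _+_; _∸_; _≤_; _<_; z<s)
  open import Data.Nat.Properties
  open import Data.Sum using (inj₁; inj₂)
  open import Relation.Nullary using (contradiction)
  open ≡ using (refl; sym; trans; cong; cong₂; subst)
  open ≡.≡-Reasoning

  ∏ₗ : ℕ → ℕ → (ℕ → A) → A
  ∏ₗ a zero    F = ε
  ∏ₗ a (suc l) F = F a ∙ ∏ₗ (suc a) l F

  ∏ₗ-++ : ∀ a l₁ l₂ F → ∏ₗ a (l₁ + l₂) F ≡ ∏ₗ a l₁ F ∙ ∏ₗ (l₁ + a) l₂ F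
  ∏ₗ-++ a zero      l₂ F = sym (identityˡ _)
  ∏ₗ-++ a (suc l₁) l₂ F = begin
    F a ∙ ∏ₗ (suc a) (l₁ + l₂) F                    ≡⟨ cong (F a ∙_) (∏ₗ-++ (suc a) l₁ l₂ F) ⟩
    F a ∙ (∏ₗ (suc a) l₁ F ∙ ∏ₗ (l₁ + suc a) l₂ F)  ≡⟨ cong (λ s → F a ∙ (∏ₗ (suc a) l₁ F ∙ ∏ₗ s l₂ F)) (+-suc l₁ a) ⟩
    F a ∙ (∏ₗ (suc a) l₁ F ∙ ∏ₗ (suc l₁ + a) l₂ F)  ≡⟨ assoc _ _ _ ⟨
    (F a ∙ ∏ₗ (suc a) l₁ F) ∙ ∏ₗ (suc l₁ + a) l₂ F  ∎

  ∏ₗ-cong : ∀ a l {F G} → (∀ x → a ≤ x → x < l + a → F x ≡ G x) → ∏ₗ a l F ≡ ∏ₗ a l G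
  ∏ₗ-cong a zero    F≗G = refl
  ∏ₗ-cong a (suc l) F≗G = cong₂ _∙_ (F≗G a ≤-refl (m<n+m a z<s))
    (∏ₗ-cong (suc a) l λ x a<x x<l+1+a → F≗G x (<⇒≤ a<x) (subst (x <_) (+-suc l a) x<l+1+a))

  ∏ₗ-shift : ∀ d a l F → ∏ₗ (d + a) l F ≡ ∏ₗ a l (F ∘ (d +_))
  ∏ₗ-shift d a zero    F = refl
  ∏ₗ-shift d a (suc l) F =
    cong (F (d + a) ∙_) (trans (cong (λ s → ∏ₗ s l F) (sym (+-suc d a))) (∏ₗ-shift d (suc a) l F))

  ∏ₗ-ε : ∀ a l → ∏ₗ a l (λ _ → ε) ≡ ε
  ∏ₗ-ε a zero    = refl
  ∏ₗ-ε a (suc l) = trans (cong (ε ∙_) (∏ₗ-ε (suc a) l)) (identityˡ ε)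

  -- Opaque, so that unification does not unfold ∏ a b into ∏ₗ a (b ∸ a) and lose a and b.
  opaque
    ∏ : ℕ → ℕ → (ℕ → A) → A
    ∏ a b = ∏ₗ a (b ∸ a)

    ∏-split : ∀ {a b c} → a ≤ b → b ≤ c → ∀ F → ∏ a c F ≡ ∏ a b F ∙ ∏ b c F
    ∏-split {a} {b} {c} a≤b b≤c F = begin
      ∏ₗ a (c ∸ a) F                              ≡⟨ cong (λ l → ∏ₗ a l F) length ⟩
      ∏ₗ a ((b ∸ a) + (c ∸ b)) F                  ≡⟨ ∏ₗ-++ a (b ∸ a) (c ∸ b) F ⟩
      ∏ₗ a (b ∸ a) F ∙ ∏ₗ ((b ∸ a) + a) (c ∸ b) F  ≡⟨ cong (λ s → ∏ₗ a (b ∸ a) F ∙ ∏ₗ s (c ∸ b) F) (m∸n+n≡m a≤b) ⟩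
      ∏ₗ a (b ∸ a) F ∙ ∏ₗ b (c ∸ b) F             ∎
      where
      length : c ∸ a ≡ (b ∸ a) + (c ∸ b)
      length = begin
        c ∸ a               ≡⟨ cong (_∸ a) (m∸n+n≡m b≤c) ⟨
        (c ∸ b) + b ∸ a     ≡⟨ +-∸-assoc (c ∸ b) a≤b ⟩
        (c ∸ b) + (b ∸ a)   ≡⟨ +-comm (c ∸ b) (b ∸ a) ⟩
        (b ∸ a) + (c ∸ b)   ∎

    ∏-cong : ∀ {a b F G} → (∀ x → a ≤ x → x < b → F x ≡ G x) → ∏ a b F ≡ ∏ a b G
    ∏-cong {a} {b} F≗G = ∏ₗ-cong a (b ∸ a) λ x a≤x x< → F≗G x a≤x (below a≤x x<)
      where
      below : ∀ {x} → a ≤ x → x < (b ∸ a) + a → x < b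
      below {x} a≤x x< with ≤-total a b
      ... | inj₁ a≤b = subst (x <_) (m∸n+n≡m a≤b) x<
      ... | inj₂ b≤a = contradiction (subst (λ l → x < l + a) (m≤n⇒m∸n≡0 b≤a) x<) (≤⇒≯ a≤x)

    ∏-shift : ∀ d {a b a′ b′} → a′ ≡ d + a → b′ ≡ d + b → ∀ F → ∏ a′ b′ F ≡ ∏ a b (F ∘ (d +_))
    ∏-shift d {a} {b} refl refl F =
      trans (cong (λ l → ∏ₗ (d + a) l F) ([m+n]∸[m+o]≡n∸o d b a)) (∏ₗ-shift d a (b ∸ a) F)

    ∏-ε : ∀ {a b F} → (∀ x → a ≤ x → x < b → F x ≡ ε) → ∏ a b F ≡ ε
    ∏-ε {a} {b} F≗ε = trans (∏-cong F≗ε) (∏ₗ-ε a (b ∸ a))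

    ∏-singleton : ∀ a F → ∏ a (suc a) F ≡ F a
    ∏-singleton a F = trans (cong (λ l → ∏ₗ a l F) (m+n∸n≡m 1 a)) (identityʳ (F a))

    ∏-pair : ∀ a F → ∏ a (suc (suc a)) F ≡ F a ∙ F (suc a)
    ∏-pair a F = trans (cong (λ l → ∏ₗ a l F) (m+n∸n≡m 2 a)) (cong (F a ∙_) (identityʳ (F (suc a))))

  ∏-first : ∀ {a b} → a < b → ∀ F → ∏ a b F ≡ F a ∙ ∏ (suc a) b F
  ∏-first {a} {b} a<b F = trans (∏-split (n≤1+n a) a<b F) (cong (_∙ ∏ (suc a) b F) (∏-singleton a F))

  ∏-last : ∀ {a b} → a ≤ b → ∀ F → ∏ a (suc b) F ≡ ∏ a b F ∙ F b
  ∏-last {a} {b} a≤b F = trans (∏-split a≤b (n≤1+n b) F) (cong (∏ a b F ∙_) (∏-singleton b F))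

module CliqueWeights {a} (M : FiniteMonoid a) where
  open FiniteMonoid M renaming (Carrier to Mon)
  open Cliques M
  open IsMonoid isMonoid using (assoc; identityˡ; identityʳ)
  open import Data.Bool using (true; false)
  open import Data.Bool.Properties using (T-≡; ¬-not)
  import Data.List as List
  open import Data.Nat using (ℕ; suc; _+_; _≤_; _<_; _≤ᵇ_; _≡ᵇ_; z<s; s≤s; z≤n)
  open import Data.Nat.Properties
  open import Data.Nat.Tactic.RingSolver using (solve)
  open import Data.Sum using (inj₁; inj₂)
  open import Function.Bundles using (Equivalence)
  open ≡ using (refl; sym; trans; cong; cong₂; subst; ≢-sym)
  open ≡.≡-Reasoning
  import Algebra.Construct.Flip.Op as Op

  module Asc  = IntervalProduct isMonoid
  module Desc = IntervalProduct (Op.isMonoid isMonoid)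
  open Asc  using () renaming (∏ to ∏↑)
  -- ∏↓ a b F = F (b ∸ 1) ⋆ ⋯ ⋆ F a
  open Desc using () renaming (∏ to ∏↓)

  -- fan p n j x multiplies the labels of the arcs (x, y) with j < y ≤ n + 1, longest first, so
  -- weight p n j runs over all arcs passing over the edge (j, j + 1), outermost first.
  fan : Clique → ℕ → ℕ → ℕ → Mon
  fan p n j x = ∏↓ (suc j) (suc (suc n)) (p x)

  weight : Clique → ℕ → ℕ → Mon
  weight p n j = ∏↑ 1 (suc j) (fan p n j)

  weight-cong : ∀ {n p q} → p ≋[ n ] q → ∀ j → weight p n j ≡ weight q n j
  weight-cong p≋q j = Asc.∏-cong λ x 1≤x x<1+j → Desc.∏-cong λ y j<y y<n+2 →
    p≋q x y (1≤x , <-≤-trans x<1+j j<y , ≤-pred y<n+2)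

  weight-1-1 : ∀ p → weight p 1 1 ≡ p 1 2
  weight-1-1 p = trans (Asc.∏-singleton 1 (fan p 1 1)) (Desc.∏-singleton 2 (p 1))

  weight-2-1 : ∀ p → weight p 2 1 ≡ p 1 3 ⋆ p 1 2
  weight-2-1 p = trans (Asc.∏-singleton 1 (fan p 2 1)) (Desc.∏-pair 2 (p 1))

  weight-2-2 : ∀ p → weight p 2 2 ≡ p 1 3 ⋆ p 2 3
  weight-2-2 p = trans (Asc.∏-pair 1 (fan p 2 2))
    (cong₂ _⋆_ (Desc.∏-singleton 3 (p 1)) (Desc.∏-singleton 3 (p 2)))

  fan-split : ∀ {n j j′} p → j ≤ j′ → j′ ≤ suc n → ∀ x → fan p n j x ≡ fan p n j′ x ⋆ ∏↓ (suc j) (suc j′) (p x)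
  fan-split p j≤j′ j′≤n+1 x = Desc.∏-split (s≤s j≤j′) (s≤s j′≤n+1) (p x)

  fan-suc : ∀ {n j} p → j ≤ n → ∀ x → fan p n j x ≡ fan p n (suc j) x ⋆ p x (suc j)
  fan-suc p j≤n x = Desc.∏-first (s≤s (s≤s j≤n)) (p x)

  private
    ≤ᵇ-true : ∀ {m n} → m ≤ n → (m ≤ᵇ n) ≡ true
    ≤ᵇ-true m≤n = Equivalence.to T-≡ (≤⇒≤ᵇ m≤n)

    ≤ᵇ-false : ∀ {m n} → n < m → (m ≤ᵇ n) ≡ false
    ≤ᵇ-false {m} {n} n<m = ¬-not λ m≤ᵇn → <⇒≱ n<m (≤ᵇ⇒≤ m n (Equivalence.from T-≡ m≤ᵇn))

    ≡ᵇ-true : ∀ n → (n ≡ᵇ n) ≡ true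
    ≡ᵇ-true n = Equivalence.to T-≡ (≡⇒≡ᵇ n n refl)

    ≡ᵇ-false : ∀ {m n} → m ≢ n → (m ≡ᵇ n) ≡ false
    ≡ᵇ-false {m} {n} m≢n = ¬-not λ m≡ᵇn → m≢n (≡ᵇ⇒≡ m n (Equivalence.from T-≡ m≡ᵇn))

  -- r glues the base of q, of arity suc m′, onto the edge (I, I + 1) of p, of arity n; r has
  -- arity N and its glued arc is (I, J).  compose writes J as suc i + suc m′, called J₀ below.
  module Composition (i m′ k : ℕ) (p q : Clique) where
    private
      I J n N : ℕ
      I = suc i
      J = suc (m′ + I)
      n = i + suc k
      N = i + (suc m′ + k)

      r : Clique
      r = compose i (suc m′) p q

      J₀≡J : suc i + suc m′ ≡ suc (m′ + suc i)
      J₀≡J = solve (i List.∷ m′ List.∷ List.[])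

      J≡i+ : suc (m′ + suc i) ≡ i + suc (suc m′)
      J≡i+ = solve (i List.∷ m′ List.∷ List.[])

      i+m≡ : i + suc m′ ≡ m′ + suc i
      i+m≡ = solve (i List.∷ m′ List.∷ List.[])

      N≡ : suc (i + (suc m′ + k)) ≡ m′ + suc (i + suc k)
      N≡ = solve (i List.∷ m′ List.∷ k List.∷ List.[])

      N₂≡ : suc (suc (i + (suc m′ + k))) ≡ m′ + suc (suc (i + suc k))
      N₂≡ = solve (i List.∷ m′ List.∷ k List.∷ List.[])

      regroup : ∀ u v w z → u ⋆ ((v ⋆ w) ⋆ z) ≡ (u ⋆ v) ⋆ (w ⋆ z)
      regroup u v w z = trans (cong (u ⋆_) (assoc v w z)) (sym (assoc u v (w ⋆ z)))

      J₀≤m′+ : ∀ {y} → I < y → suc i + suc m′ ≤ m′ + y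
      J₀≤m′+ {y} I<y = subst (_≤ m′ + y) (sym (trans J₀≡J (sym (+-suc m′ I)))) (+-monoʳ-≤ m′ I<y)

      J₀<m′+ : ∀ {y} → suc I < y → suc i + suc m′ < m′ + y
      J₀<m′+ {y} I+1<y = subst (_< m′ + y) (sym (trans J₀≡J (sym (+-suc m′ I)))) (+-monoʳ-< m′ I+1<y)

      <J⇒<J₀ : ∀ {x} → x < J → x < suc i + suc m′
      <J⇒<J₀ {x} = subst (x <_) (sym J₀≡J)

      J<⇒J₀< : ∀ {y} → J < y → suc i + suc m′ < y
      J<⇒J₀< {y} = subst (_< y) (sym J₀≡J)

      i+<J₀ : ∀ {y} → y < suc (suc m′) → i + y < suc i + suc m′
      i+<J₀ {y} y<m+1 = subst (i + y <_) (+-suc i (suc m′)) (+-monoʳ-< i y<m+1)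

      I<i+ : ∀ {x} → 1 < x → I < i + x
      I<i+ {x} 1<x = subst (_< i + x) (+-comm i 1) (+-monoʳ-< i 1<x)

      I≤i+ : ∀ {j} → 0 < j → I ≤ i + j
      I≤i+ {j} 0<j = subst (_≤ i + j) (+-comm i 1) (+-monoʳ-≤ i 0<j)

      I<m′+ : ∀ {x} → I < x → I < m′ + x
      I<m′+ I<x = <-≤-trans (m<m+n I z<s) (J₀≤m′+ I<x)

      I≤n : I ≤ n
      I≤n = m<m+n i z<s

      m′+≤N : ∀ {j} → j ≤ suc n → m′ + j ≤ suc N
      m′+≤N {j} j≤n+1 = subst (m′ + j ≤_) (sym N≡) (+-monoʳ-≤ m′ j≤n+1)

      J≤N : J ≤ suc N
      J≤N = subst (_≤ suc N) (+-suc m′ I) (m′+≤N (s≤s I≤n))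

    compose-p-below : ∀ {x y} → x < I → y ≤ I → r x y ≡ p x y
    compose-p-below {x} {y} x<I y≤I
      rewrite ≡ᵇ-false (<⇒≢ x<I) | ≤ᵇ-false {I} {x} x<I | ≤ᵇ-true (<⇒≤ x<I) | ≤ᵇ-true y≤I = refl

    compose-gap : ∀ {x y} → x < I → I < y → y < J → r x y ≡ 𝟙
    compose-gap {x} {y} x<I I<y y<J
      rewrite ≡ᵇ-false (<⇒≢ x<I) | ≤ᵇ-false {I} {x} x<I | ≤ᵇ-true (<⇒≤ x<I) | ≤ᵇ-false {y} {I} I<y
            | ≤ᵇ-false (<J⇒<J₀ y<J) = refl

    compose-p-over : ∀ {x y} → x < I → I < y → r x (m′ + y) ≡ p x y
    compose-p-over {x} {y} x<I I<y
      rewrite ≡ᵇ-false (<⇒≢ x<I) | ≤ᵇ-false {I} {x} x<I | ≤ᵇ-true (<⇒≤ x<I)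
            | ≤ᵇ-false {m′ + y} {I} (I<m′+ I<y) | ≤ᵇ-true (J₀≤m′+ I<y) | m+n∸m≡n m′ y = refl

    compose-p-at-gluing : ∀ {y} → suc I < y → r I (m′ + y) ≡ p I y
    compose-p-at-gluing {y} I+1<y
      rewrite ≡ᵇ-true I | ≡ᵇ-false {m′ + y} (≢-sym (<⇒≢ (J₀<m′+ I+1<y))) | ≤ᵇ-true (≤-refl {I})
            | ≤ᵇ-false (J₀<m′+ I+1<y) | ≤ᵇ-false {m′ + y} {I} (I<m′+ (<-trans (n<1+n I) I+1<y))
            | ≤ᵇ-true (<⇒≤ (J₀<m′+ I+1<y)) | m+n∸m≡n m′ y = refl

    compose-glued : r I J ≡ p I (suc I) ⋆ q 1 (suc (suc m′))
    compose-glued = trans (cong (r I) (sym J₀≡J)) glued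
      where
      glued : r I (suc i + suc m′) ≡ p I (suc I) ⋆ q 1 (suc (suc m′))
      glued rewrite ≡ᵇ-true I | ≡ᵇ-true (suc i + suc m′) = refl

    compose-q-base : ∀ {y} → y < suc (suc m′) → r I (i + y) ≡ q 1 y
    compose-q-base {y} y<m+1
      rewrite ≡ᵇ-true I | ≡ᵇ-false (<⇒≢ (i+<J₀ y<m+1)) | ≤ᵇ-true (≤-refl {I}) | ≤ᵇ-true (<⇒≤ (i+<J₀ y<m+1))
            | m+n∸m≡n i y | m+n∸n≡m 1 i = refl

    compose-q : ∀ {x y} → 1 < x → y ≤ suc (suc m′) → r (i + x) (i + y) ≡ q x y
    compose-q {x} {y} 1<x y≤m+1
      rewrite ≡ᵇ-false {i + x} {I} (≢-sym (<⇒≢ (I<i+ 1<x))) | ≤ᵇ-true (<⇒≤ (I<i+ 1<x))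
            | ≤ᵇ-true (subst (i + y ≤_) (+-suc i (suc m′)) (+-monoʳ-≤ i y≤m+1))
            | m+n∸m≡n i x | m+n∸m≡n i y = refl

    compose-q-gap : ∀ {x y} → I < x → x < J → J < y → r x y ≡ 𝟙
    compose-q-gap {x} {y} I<x x<J J<y
      rewrite ≡ᵇ-false {x} {I} (≢-sym (<⇒≢ I<x)) | ≤ᵇ-true (<⇒≤ I<x) | ≤ᵇ-false (J<⇒J₀< J<y)
            | ≤ᵇ-false {x} {I} I<x | ≤ᵇ-false (<J⇒<J₀ x<J) = refl

    compose-p-above : ∀ {x y} → I < x → x < y → r (m′ + x) (m′ + y) ≡ p x y
    compose-p-above {x} {y} I<x x<y
      rewrite ≡ᵇ-false {m′ + x} {I} (≢-sym (<⇒≢ (I<m′+ I<x))) | ≤ᵇ-true (<⇒≤ (I<m′+ I<x))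
            | ≤ᵇ-false (J₀<m′+ (≤-<-trans I<x x<y)) | ≤ᵇ-false {m′ + x} {I} (I<m′+ I<x) | ≤ᵇ-true (J₀≤m′+ I<x)
            | ≤ᵇ-false {m′ + y} {I} (I<m′+ (<-trans I<x x<y)) | ≤ᵇ-true (<⇒≤ (J₀<m′+ (≤-<-trans I<x x<y)))
            | m+n∸m≡n m′ x | m+n∸m≡n m′ y = refl

    fan-compose-shifted : ∀ {x j j′} x′ → j′ ≡ m′ + j → (∀ {y} → j < y → r x′ (m′ + y) ≡ p x y) →
                          fan r N j′ x′ ≡ fan p n j x
    fan-compose-shifted {x} {j} x′ j′≡ r≗p =
      trans (Desc.∏-shift m′ (trans (cong suc j′≡) (sym (+-suc m′ j))) N₂≡ (r x′))
            (Desc.∏-cong λ y j<y _ → r≗p j<y)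

    weight-compose-left : ∀ {j} → j < I → weight r N j ≡ weight p n j
    weight-compose-left {j} j<I = Asc.∏-cong λ x _ x<1+j → fan-left (≤-<-trans (≤-pred x<1+j) j<I)
      where
      fan-left : ∀ {x} → x < I → fan r N j x ≡ fan p n j x
      fan-left {x} x<I = begin
        fan r N j x
          ≡⟨ fan-split r (≤-trans (<⇒≤ j<I) (m≤n+m I m′)) (m′+≤N (≤-trans I≤n (n≤1+n n))) x ⟩
        fan r N (m′ + I) x ⋆ ∏↓ (suc j) J (r x)
          ≡⟨ cong₂ _⋆_ (fan-compose-shifted x refl (compose-p-over x<I))
                       (Desc.∏-split (m≤n⇒m≤1+n j<I) (s≤s (m≤n+m I m′)) (r x)) ⟩
        fan p n I x ⋆ (∏↓ (suc I) J (r x) ⋆ ∏↓ (suc j) (suc I) (r x))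
          ≡⟨ cong₂ (λ gap below → fan p n I x ⋆ (gap ⋆ below))
                   (Desc.∏-ε λ y I<y y<J → compose-gap x<I I<y y<J)
                   (Desc.∏-cong λ y _ y<I+1 → compose-p-below x<I (≤-pred y<I+1)) ⟩
        fan p n I x ⋆ (𝟙 ⋆ ∏↓ (suc j) (suc I) (p x))
          ≡⟨ cong (fan p n I x ⋆_) (identityˡ _) ⟩
        fan p n I x ⋆ ∏↓ (suc j) (suc I) (p x)
          ≡⟨ fan-split p (<⇒≤ j<I) (≤-trans I≤n (n≤1+n n)) x ⟨
        fan p n j x ∎

    weight-compose-right : ∀ {j} → I < j → weight r N (m′ + j) ≡ weight p n j
    weight-compose-right {j} I<j = begin
      ∏↑ 1 (suc (m′ + j)) F
        ≡⟨ Asc.∏-split (s≤s z≤n) (s≤s (≤-trans (<⇒≤ I<j) (m≤n+m j m′))) F ⟩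
      ∏↑ 1 (suc I) F ⋆ ∏↑ (suc I) (suc (m′ + j)) F
        ≡⟨ cong (∏↑ 1 (suc I) F ⋆_) (Asc.∏-split (s≤s (m≤n+m I m′)) (s≤s (+-monoʳ-≤ m′ (<⇒≤ I<j))) F) ⟩
      ∏↑ 1 (suc I) F ⋆ (∏↑ (suc I) J F ⋆ ∏↑ J (suc (m′ + j)) F)
        ≡⟨ cong₂ (λ left right → left ⋆ right) (Asc.∏-cong λ x _ x<I+1 → fan-up-to-gluing (≤-pred x<I+1))
                 (cong₂ _⋆_ (Asc.∏-ε λ x I<x x<J → fan-q-block I<x x<J) p-above) ⟩
      ∏↑ 1 (suc I) (fan p n j) ⋆ (𝟙 ⋆ ∏↑ (suc I) (suc j) (fan p n j))
        ≡⟨ cong (∏↑ 1 (suc I) (fan p n j) ⋆_) (identityˡ _) ⟩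
      ∏↑ 1 (suc I) (fan p n j) ⋆ ∏↑ (suc I) (suc j) (fan p n j)
        ≡⟨ Asc.∏-split (s≤s z≤n) (m≤n⇒m≤1+n I<j) (fan p n j) ⟨
      weight p n j ∎
      where
      F : ℕ → Mon
      F = fan r N (m′ + j)

      fan-up-to-gluing : ∀ {x} → x ≤ I → F x ≡ fan p n j x
      fan-up-to-gluing {x} x≤I with m≤n⇒m<n∨m≡n x≤I
      ... | inj₁ x<I = fan-compose-shifted x refl λ j<y → compose-p-over x<I (<-trans I<j j<y)
      ... | inj₂ refl = fan-compose-shifted I refl λ j<y → compose-p-at-gluing (≤-<-trans I<j j<y)

      fan-q-block : ∀ {x} → I < x → x < J → F x ≡ 𝟙
      fan-q-block I<x x<J = Desc.∏-ε λ y m′+j<y _ →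
        compose-q-gap I<x x<J (≤-<-trans (+-monoʳ-< m′ I<j) m′+j<y)

      p-above : ∏↑ J (suc (m′ + j)) F ≡ ∏↑ (suc I) (suc j) (fan p n j)
      p-above = trans (Asc.∏-shift m′ (sym (+-suc m′ I)) (sym (+-suc m′ j)) F)
        (Asc.∏-cong λ x I<x x<j+1 → fan-compose-shifted (m′ + x) refl λ j<y →
          compose-p-above I<x (≤-<-trans (≤-pred x<j+1) j<y))

    weight-compose-middle : ∀ {j} → 0 < j → j ≤ suc m′ →
                            weight r N (i + j) ≡ weight p n I ⋆ weight q (suc m′) j
    weight-compose-middle {j} 0<j j≤m = begin
      ∏↑ 1 (suc (i + j)) F
        ≡⟨ Asc.∏-split (s≤s z≤n) (s≤s (m≤m+n i j)) F ⟩
      ∏↑ 1 I F ⋆ ∏↑ I (suc (i + j)) F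
        ≡⟨ cong (∏↑ 1 I F ⋆_) (Asc.∏-first (s≤s (I≤i+ 0<j)) F) ⟩
      ∏↑ 1 I F ⋆ (F I ⋆ ∏↑ (suc I) (suc (i + j)) F)
        ≡⟨ cong₂ (λ left right → left ⋆ right) (Asc.∏-cong λ x _ x<I → fan-p-left x<I)
                 (cong₂ _⋆_ fan-gluing q-right) ⟩
      ∏↑ 1 I (fan p n I) ⋆ ((fan p n I I ⋆ fan q (suc m′) j 1) ⋆ ∏↑ 2 (suc j) (fan q (suc m′) j))
        ≡⟨ regroup _ _ _ _ ⟩
      (∏↑ 1 I (fan p n I) ⋆ fan p n I I) ⋆ (fan q (suc m′) j 1 ⋆ ∏↑ 2 (suc j) (fan q (suc m′) j))
        ≡⟨ cong₂ _⋆_ (Asc.∏-last (s≤s z≤n) (fan p n I)) (Asc.∏-first (s≤s 0<j) (fan q (suc m′) j)) ⟨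
      weight p n I ⋆ weight q (suc m′) j ∎
      where
      F : ℕ → Mon
      F = fan r N (i + j)

      i+j≤m′+I : i + j ≤ m′ + I
      i+j≤m′+I = subst (i + j ≤_) i+m≡ (+-monoʳ-≤ i j≤m)

      fan-p-left : ∀ {x} → x < I → F x ≡ fan p n I x
      fan-p-left {x} x<I = begin
        F x                                        ≡⟨ fan-split r i+j≤m′+I (≤-trans (n≤1+n _) J≤N) x ⟩
        fan r N (m′ + I) x ⋆ ∏↓ (suc (i + j)) J (r x)
          ≡⟨ cong₂ _⋆_ (fan-compose-shifted x refl (compose-p-over x<I))
                       (Desc.∏-ε λ y i+j<y y<J → compose-gap x<I (≤-<-trans (I≤i+ 0<j) i+j<y) y<J) ⟩
        fan p n I x ⋆ 𝟙                            ≡⟨ identityʳ _ ⟩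
        fan p n I x                                ∎

      fan-gluing : F I ≡ fan p n I I ⋆ fan q (suc m′) j 1
      fan-gluing = begin
        F I                                        ≡⟨ fan-split r (≤-trans i+j≤m′+I (n≤1+n _)) J≤N I ⟩
        fan r N J I ⋆ ∏↓ (suc (i + j)) (suc J) (r I)
          ≡⟨ cong₂ _⋆_ (fan-compose-shifted I (sym (+-suc m′ I)) compose-p-at-gluing)
                       (Desc.∏-last (s≤s i+j≤m′+I) (r I)) ⟩
        fan p n (suc I) I ⋆ (r I J ⋆ ∏↓ (suc (i + j)) J (r I))
          ≡⟨ cong₂ (λ glued below → fan p n (suc I) I ⋆ (glued ⋆ below)) compose-glued q-base ⟩
        fan p n (suc I) I ⋆ ((p I (suc I) ⋆ q 1 (suc (suc m′))) ⋆ ∏↓ (suc j) (suc (suc m′)) (q 1))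
          ≡⟨ regroup _ _ _ _ ⟩
        (fan p n (suc I) I ⋆ p I (suc I)) ⋆ (q 1 (suc (suc m′)) ⋆ ∏↓ (suc j) (suc (suc m′)) (q 1))
          ≡⟨ cong₂ _⋆_ (fan-suc p I≤n I) (Desc.∏-last (s≤s j≤m) (q 1)) ⟨
        fan p n I I ⋆ fan q (suc m′) j 1           ∎
        where
        q-base : ∏↓ (suc (i + j)) J (r I) ≡ ∏↓ (suc j) (suc (suc m′)) (q 1)
        q-base = trans (Desc.∏-shift i (sym (+-suc i j)) J≡i+ (r I))
                       (Desc.∏-cong λ y _ y<m+2 → compose-q-base y<m+2)

      fan-q : ∀ {x} → 1 < x → x ≤ j → F (i + x) ≡ fan q (suc m′) j x
      fan-q {x} 1<x x≤j = begin
        F (i + x)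
          ≡⟨ fan-split r (+-monoʳ-≤ i (m≤n⇒m≤1+n j≤m)) (subst (_≤ suc N) J≡i+ J≤N) (i + x) ⟩
        fan r N (i + suc (suc m′)) (i + x) ⋆ ∏↓ (suc (i + j)) (suc (i + suc (suc m′))) (r (i + x))
          ≡⟨ cong₂ _⋆_ (Desc.∏-ε λ y J<y _ → compose-q-gap (I<i+ 1<x) i+x<J (subst (_< y) (sym J≡i+) J<y))
                       (Desc.∏-shift i (sym (+-suc i j)) (sym (+-suc i (suc (suc m′)))) (r (i + x))) ⟩
        𝟙 ⋆ ∏↓ (suc j) (suc (suc (suc m′))) (λ y → r (i + x) (i + y))
          ≡⟨ identityˡ _ ⟩
        ∏↓ (suc j) (suc (suc (suc m′))) (λ y → r (i + x) (i + y))
          ≡⟨ Desc.∏-cong (λ y _ y<m+2 → compose-q 1<x (≤-pred y<m+2)) ⟩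
        fan q (suc m′) j x ∎
        where
        i+x<J : i + x < J
        i+x<J = subst (i + x <_) (sym J≡i+) (+-monoʳ-< i (s≤s (≤-trans x≤j j≤m)))

      q-right : ∏↑ (suc I) (suc (i + j)) F ≡ ∏↑ 2 (suc j) (fan q (suc m′) j)
      q-right = trans (Asc.∏-shift i (+-comm 2 i) (sym (+-suc i j)) F)
                      (Asc.∏-cong λ x 1<x x<j+1 → fan-q 1<x (≤-pred x<j+1))
module PolynomialAlgebra {c ℓ a} (K : Field c ℓ) (M : FiniteMonoid a) where
  open Field K renaming (Carrier to 𝕂)
  open FiniteMonoid M using (_⋆_; 𝟙; isMonoid) renaming (_≟_ to _≟M_)
  open Polynomials K M
  open import Data.List using (List; []; _∷_; map; _++_; deduplicate)
  open import Data.List.Membership.Propositional using (_∈_)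
  open import Data.List.Membership.Propositional.Properties using (∈-++⁺ˡ; ∈-++⁺ʳ; ∈-deduplicate⁺)
  open import Data.List.Relation.Unary.Any using (here; there)
  open import Data.List.Relation.Unary.All as All using (All; []; _∷_)
  open import Data.List.Relation.Unary.AllPairs using ([]; _∷_)
  import Data.List.Relation.Unary.Unique.DecPropositional as DecUnique
  import Data.List.Relation.Unary.Unique.DecPropositional.Properties as DecUnique
  import Data.List.Properties as List
  open import Relation.Binary.Bundles using (Setoid)
  open import Relation.Nullary using (Dec; yes; no; contradiction)
  open import Relation.Binary.Reasoning.Setoid setoid
  open import Algebra.Properties.CommutativeSemigroup +-commutativeSemigroup
    using () renaming (interchange to +-interchange)
  open import Algebra.Properties.CommutativeSemigroup *-commutativeSemigroup
    using () renaming (x∙yz≈y∙xz to *-left-swap)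
  private
    module Mon = IsMonoid isMonoid

  _≟W_ : (u v : Word) → Dec (u ≡ v)
  _≟W_ = List.≡-dec _≟M_

  eval : (Word → 𝕂) → Poly → 𝕂
  eval h []            = 0#
  eval h ((k , u) ∷ f) = k * h u + eval h f

  -- Equivalent to _≈ₚ_ (≃⇒≈ₚ, ≈ₚ⇒≃), but the operations are much easier to control through
  -- eval than through coeff.
  infix 4 _≃_
  record _≃_ (f g : Poly) : Set (c ⊔ ℓ ⊔ a) where
    constructor mk≃
    field eval-≈ : ∀ h → eval h f ≈ eval h g
  open _≃_

  ≃-isEquivalence : IsEquivalence _≃_
  ≃-isEquivalence = record
    { refl  = mk≃ λ h → refl
    ; sym   = λ f≃g → mk≃ λ h → sym (eval-≈ f≃g h)
    ; trans = λ f≃g g≃r → mk≃ λ h → trans (eval-≈ f≃g h) (eval-≈ g≃r h)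
    }

  ≃-setoid : Setoid (c ⊔ a) (c ⊔ ℓ ⊔ a)
  ≃-setoid = record { isEquivalence = ≃-isEquivalence }

  private
    module ≃ = IsEquivalence ≃-isEquivalence

  one : Poly
  one = (1# , []) ∷ []

  eval-cong : ∀ {h h′} f → (∀ u → h u ≈ h′ u) → eval h f ≈ eval h′ f
  eval-cong []            h≈h′ = refl
  eval-cong ((k , u) ∷ f) h≈h′ = +-cong (*-cong refl (h≈h′ u)) (eval-cong f h≈h′)

  eval-++ : ∀ h f g → eval h (f ++ g) ≈ eval h f + eval h g
  eval-++ h []            g = sym (+-identityˡ _)
  eval-++ h ((k , u) ∷ f) g = trans (+-cong refl (eval-++ h f g)) (sym (+-assoc _ _ _))

  eval-+ : ∀ h₁ h₂ f → eval (λ u → h₁ u + h₂ u) f ≈ eval h₁ f + eval h₂ f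
  eval-+ h₁ h₂ []            = sym (+-identityˡ 0#)
  eval-+ h₁ h₂ ((k , u) ∷ f) = begin
    k * (h₁ u + h₂ u) + eval (λ u → h₁ u + h₂ u) f    ≈⟨ +-cong (distribˡ k _ _) (eval-+ h₁ h₂ f) ⟩
    (k * h₁ u + k * h₂ u) + (eval h₁ f + eval h₂ f)  ≈⟨ +-interchange _ _ _ _ ⟩
    (k * h₁ u + eval h₁ f) + (k * h₂ u + eval h₂ f)  ∎

  eval-scaled : ∀ x h f → eval (λ u → x * h u) f ≈ x * eval h f
  eval-scaled x h []            = sym (zeroʳ x)
  eval-scaled x h ((k , u) ∷ f) = begin
    k * (x * h u) + eval (λ u → x * h u) f  ≈⟨ +-cong (*-left-swap k x (h u)) (eval-scaled x h f) ⟩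
    x * (k * h u) + x * eval h f            ≈⟨ distribˡ x _ _ ⟨
    x * (k * h u + eval h f)                ∎

  eval-map : ∀ h x (φ : Word → Word) g →
             eval h (map (λ t → (x * proj₁ t , φ (proj₂ t))) g) ≈ x * eval (h ∘ φ) g
  eval-map h x φ []            = sym (zeroʳ x)
  eval-map h x φ ((k , u) ∷ g) =
    trans (+-cong (*-assoc x k _) (eval-map h x φ g)) (sym (distribˡ x _ _))

  eval-• : ∀ h x f → eval h (x •ₚ f) ≈ x * eval h f
  eval-• h x f = eval-map h x id f

  eval-· : ∀ h f g → eval h (f ·ₚ g) ≈ eval (λ u → eval (λ v → h (u ++ v)) g) f
  eval-· h []            g = refl
  eval-· h ((k , u) ∷ f) g =
    trans (eval-++ h (map (λ t → (k * proj₁ t , u ++ proj₂ t)) g) (f ·ₚ g))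
          (+-cong (eval-map h k (u ++_) g) (eval-· h f g))

  eval-* : ∀ h x f → eval h (x *ₚ f) ≡ eval (h ∘ actW x) f
  eval-* h x []            = ≡.refl
  eval-* h x ((k , u) ∷ f) = ≡.cong (k * h (actW x u) +_) (eval-* h x f)

  eval-one : ∀ h → eval h one ≈ h []
  eval-one h = trans (+-identityʳ _) (*-identityˡ _)

  +ₚ-cong : ∀ {f f′ g g′} → f ≃ f′ → g ≃ g′ → f +ₚ g ≃ f′ +ₚ g′
  +ₚ-cong {f} {f′} {g} {g′} f≃f′ g≃g′ = mk≃ λ h → begin
    eval h (f +ₚ g)               ≈⟨ eval-++ h f g ⟩
    eval h f + eval h g           ≈⟨ +-cong (eval-≈ f≃f′ h) (eval-≈ g≃g′ h) ⟩
    eval h f′ + eval h g′         ≈⟨ eval-++ h f′ g′ ⟨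
    eval h (f′ +ₚ g′)             ∎

  ·ₚ-cong : ∀ {f f′ g g′} → f ≃ f′ → g ≃ g′ → f ·ₚ g ≃ f′ ·ₚ g′
  ·ₚ-cong {f} {f′} {g} {g′} f≃f′ g≃g′ = mk≃ λ h → begin
    eval h (f ·ₚ g)                                   ≈⟨ eval-· h f g ⟩
    eval (λ u → eval (λ v → h (u ++ v)) g) f          ≈⟨ eval-cong f (λ u → eval-≈ g≃g′ _) ⟩
    eval (λ u → eval (λ v → h (u ++ v)) g′) f         ≈⟨ eval-≈ f≃f′ _ ⟩
    eval (λ u → eval (λ v → h (u ++ v)) g′) f′        ≈⟨ eval-· h f′ g′ ⟨
    eval h (f′ ·ₚ g′)                                 ∎

  ·ₚ-congˡ : ∀ f {g g′} → g ≃ g′ → f ·ₚ g ≃ f ·ₚ g′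
  ·ₚ-congˡ f = ·ₚ-cong (≃.refl {f})

  ·ₚ-congʳ : ∀ g {f f′} → f ≃ f′ → f ·ₚ g ≃ f′ ·ₚ g
  ·ₚ-congʳ g f≃f′ = ·ₚ-cong f≃f′ (≃.refl {g})

  *ₚ-cong : ∀ x {f f′} → f ≃ f′ → x *ₚ f ≃ x *ₚ f′
  *ₚ-cong x {f} {f′} f≃f′ = mk≃ λ h → begin
    eval h (x *ₚ f)          ≡⟨ eval-* h x f ⟩
    eval (h ∘ actW x) f      ≈⟨ eval-≈ f≃f′ _ ⟩
    eval (h ∘ actW x) f′     ≡⟨ eval-* h x f′ ⟨
    eval h (x *ₚ f′)         ∎

  ·ₚ-assoc : ∀ f g r → (f ·ₚ g) ·ₚ r ≃ f ·ₚ (g ·ₚ r)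
  ·ₚ-assoc f g r = mk≃ λ h → begin
    eval h ((f ·ₚ g) ·ₚ r)                                               ≈⟨ eval-· h (f ·ₚ g) r ⟩
    eval (λ u → eval (λ v → h (u ++ v)) r) (f ·ₚ g)                      ≈⟨ eval-· _ f g ⟩
    eval (λ u → eval (λ u′ → eval (λ v → h ((u ++ u′) ++ v)) r) g) f
      ≈⟨ eval-cong f (λ u → eval-cong g λ u′ → eval-cong r λ v → reflexive (≡.cong h (List.++-assoc u u′ v))) ⟩
    eval (λ u → eval (λ u′ → eval (λ v → h (u ++ (u′ ++ v))) r) g) f     ≈⟨ eval-cong f (λ u → eval-· _ g r) ⟨
    eval (λ u → eval (λ w → h (u ++ w)) (g ·ₚ r)) f                      ≈⟨ eval-· h f (g ·ₚ r) ⟨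
    eval h (f ·ₚ (g ·ₚ r))                                               ∎

  ·ₚ-identityˡ : ∀ f → one ·ₚ f ≃ f
  ·ₚ-identityˡ f = mk≃ λ h → trans (eval-· h one f) (eval-one λ u → eval (λ v → h (u ++ v)) f)

  ·ₚ-identityʳ : ∀ f → f ·ₚ one ≃ f
  ·ₚ-identityʳ f = mk≃ λ h → trans (eval-· h f one)
    (eval-cong f λ u → trans (eval-one (λ v → h (u ++ v))) (reflexive (≡.cong h (List.++-identityʳ u))))

  ·ₚ-distribʳ-+ₚ : ∀ f g r → (f +ₚ g) ·ₚ r ≃ (f ·ₚ r) +ₚ (g ·ₚ r)
  ·ₚ-distribʳ-+ₚ f g r = mk≃ eq
    where
    eq : ∀ h → eval h ((f +ₚ g) ·ₚ r) ≈ eval h ((f ·ₚ r) +ₚ (g ·ₚ r))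
    eq h = begin
      eval h ((f +ₚ g) ·ₚ r)                      ≈⟨ eval-· h (f +ₚ g) r ⟩
      eval H (f +ₚ g)                             ≈⟨ eval-++ H f g ⟩
      eval H f + eval H g                         ≈⟨ +-cong (eval-· h f r) (eval-· h g r) ⟨
      eval h (f ·ₚ r) + eval h (g ·ₚ r)           ≈⟨ eval-++ h (f ·ₚ r) (g ·ₚ r) ⟨
      eval h ((f ·ₚ r) +ₚ (g ·ₚ r))               ∎
      where H = λ u → eval (λ v → h (u ++ v)) r

  ·ₚ-distribˡ-+ₚ : ∀ f g r → f ·ₚ (g +ₚ r) ≃ (f ·ₚ g) +ₚ (f ·ₚ r)
  ·ₚ-distribˡ-+ₚ f g r = mk≃ λ h → begin
    eval h (f ·ₚ (g ++ r))                                                      ≈⟨ eval-· h f (g ++ r) ⟩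
    eval (λ u → eval (λ v → h (u ++ v)) (g ++ r)) f                             ≈⟨ eval-cong f (λ u → eval-++ _ g r) ⟩
    eval (λ u → eval (λ v → h (u ++ v)) g + eval (λ v → h (u ++ v)) r) f        ≈⟨ eval-+ _ _ f ⟩
    eval (λ u → eval (λ v → h (u ++ v)) g) f + eval (λ u → eval (λ v → h (u ++ v)) r) f
      ≈⟨ +-cong (eval-· h f g) (eval-· h f r) ⟨
    eval h (f ·ₚ g) + eval h (f ·ₚ r)                                           ≈⟨ eval-++ h (f ·ₚ g) (f ·ₚ r) ⟨
    eval h ((f ·ₚ g) ++ (f ·ₚ r))                                               ∎

  ·ₚ-•ₚˡ : ∀ x f g → (x •ₚ f) ·ₚ g ≃ x •ₚ (f ·ₚ g)
  ·ₚ-•ₚˡ x f g = mk≃ eq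
    where
    eq : ∀ h → eval h ((x •ₚ f) ·ₚ g) ≈ eval h (x •ₚ (f ·ₚ g))
    eq h = begin
      eval h ((x •ₚ f) ·ₚ g)       ≈⟨ eval-· h (x •ₚ f) g ⟩
      eval H (x •ₚ f)              ≈⟨ eval-• H x f ⟩
      x * eval H f                 ≈⟨ *-cong refl (eval-· h f g) ⟨
      x * eval h (f ·ₚ g)          ≈⟨ eval-• h x (f ·ₚ g) ⟨
      eval h (x •ₚ (f ·ₚ g))       ∎
      where H = λ u → eval (λ v → h (u ++ v)) g

  ·ₚ-•ₚʳ : ∀ x f g → f ·ₚ (x •ₚ g) ≃ x •ₚ (f ·ₚ g)
  ·ₚ-•ₚʳ x f g = mk≃ λ h → begin
    eval h (f ·ₚ (x •ₚ g))                              ≈⟨ eval-· h f (x •ₚ g) ⟩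
    eval (λ u → eval (λ v → h (u ++ v)) (x •ₚ g)) f     ≈⟨ eval-cong f (λ u → eval-• _ x g) ⟩
    eval (λ u → x * eval (λ v → h (u ++ v)) g) f        ≈⟨ eval-scaled x _ f ⟩
    x * eval (λ u → eval (λ v → h (u ++ v)) g) f        ≈⟨ *-cong refl (eval-· h f g) ⟨
    x * eval h (f ·ₚ g)                                 ≈⟨ eval-• h x (f ·ₚ g) ⟨
    eval h (x •ₚ (f ·ₚ g))                              ∎

  *ₚ-+ₚ : ∀ x f g → x *ₚ (f +ₚ g) ≡ (x *ₚ f) +ₚ (x *ₚ g)
  *ₚ-+ₚ x = List.map-++ _

  *ₚ-•ₚ : ∀ x y f → x *ₚ (y •ₚ f) ≡ y •ₚ (x *ₚ f)
  *ₚ-•ₚ x y f = ≡.trans (≡.sym (List.map-∘ f)) (List.map-∘ f)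

  *ₚ-·ₚ : ∀ x f g → x *ₚ (f ·ₚ g) ≃ (x *ₚ f) ·ₚ (x *ₚ g)
  *ₚ-·ₚ x f g = mk≃ λ h → begin
    eval h (x *ₚ (f ·ₚ g))                                        ≡⟨ eval-* h x (f ·ₚ g) ⟩
    eval (h ∘ actW x) (f ·ₚ g)                                    ≈⟨ eval-· _ f g ⟩
    eval (λ u → eval (λ v → h (actW x (u ++ v))) g) f
      ≈⟨ eval-cong f (λ u → eval-cong g λ v → reflexive (≡.cong h (List.map-++ (x ⋆_) u v))) ⟩
    eval (λ u → eval (λ v → h (actW x u ++ actW x v)) g) f        ≡⟨ eval-* _ x f ⟨
    eval (λ u → eval (λ v → h (u ++ actW x v)) g) (x *ₚ f)        ≈⟨ eval-cong (x *ₚ f) (λ u → reflexive (eval-* (λ v → h (u ++ v)) x g)) ⟨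
    eval (λ u → eval (λ v → h (u ++ v)) (x *ₚ g)) (x *ₚ f)        ≈⟨ eval-· h (x *ₚ f) (x *ₚ g) ⟨
    eval h ((x *ₚ f) ·ₚ (x *ₚ g))                                 ∎

  *ₚ-*ₚ : ∀ x y f → x *ₚ (y *ₚ f) ≃ (x ⋆ y) *ₚ f
  *ₚ-*ₚ x y f = mk≃ λ h → begin
    eval h (x *ₚ (y *ₚ f))               ≡⟨ eval-* h x (y *ₚ f) ⟩
    eval (h ∘ actW x) (y *ₚ f)           ≡⟨ eval-* _ y f ⟩
    eval (h ∘ actW x ∘ actW y) f         ≈⟨ eval-cong f (λ u → reflexive (≡.cong h (actW-actW u))) ⟩
    eval (h ∘ actW (x ⋆ y)) f            ≡⟨ eval-* h (x ⋆ y) f ⟨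
    eval h ((x ⋆ y) *ₚ f)                ∎
    where
    actW-actW : ∀ u → actW x (actW y u) ≡ actW (x ⋆ y) u
    actW-actW u = ≡.trans (≡.sym (List.map-∘ u)) (List.map-cong (λ z → ≡.sym (Mon.assoc x y z)) u)

  *ₚ-identityˡ : ∀ f → 𝟙 *ₚ f ≃ f
  *ₚ-identityˡ f = mk≃ λ h → trans (reflexive (eval-* h 𝟙 f))
    (eval-cong f λ u → reflexive (≡.cong h (≡.trans (List.map-cong Mon.identityˡ u) (List.map-id u))))

  δ : Word → Word → 𝕂
  δ u w with u ≟W w
  ... | yes _ = 1#
  ... | no  _ = 0#

  coeff-cons : ∀ k u f w → coeff ((k , u) ∷ f) w ≈ δ u w * k + coeff f w
  coeff-cons k u f w with u ≟W w
  ... | yes _ = +-cong (sym (*-identityˡ k)) refl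
  ... | no  _ = trans (sym (+-identityˡ _)) (+-cong (sym (zeroˡ k)) refl)

  coeff-eval : ∀ f w → coeff f w ≈ eval (λ u → δ u w) f
  coeff-eval []            w = refl
  coeff-eval ((k , u) ∷ f) w =
    trans (coeff-cons k u f w) (+-cong (*-comm _ k) (coeff-eval f w))

  ≃⇒≈ₚ : ∀ {f g} → f ≃ g → f ≈ₚ g
  ≃⇒≈ₚ {f} {g} f≃g w = trans (coeff-eval f w) (trans (eval-≈ f≃g _) (sym (coeff-eval g w)))

  sumOver : List Word → (Word → 𝕂) → 𝕂
  sumOver []      F = 0#
  sumOver (w ∷ L) F = F w + sumOver L F

  sumOver-cong : ∀ L {F G} → (∀ w → F w ≈ G w) → sumOver L F ≈ sumOver L G
  sumOver-cong []      F≈G = refl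
  sumOver-cong (w ∷ L) F≈G = +-cong (F≈G w) (sumOver-cong L F≈G)

  sumOver-+ : ∀ L F G → sumOver L (λ w → F w + G w) ≈ sumOver L F + sumOver L G
  sumOver-+ []      F G = sym (+-identityˡ 0#)
  sumOver-+ (w ∷ L) F G = begin
    (F w + G w) + sumOver L (λ w → F w + G w)   ≈⟨ +-cong refl (sumOver-+ L F G) ⟩
    (F w + G w) + (sumOver L F + sumOver L G)   ≈⟨ +-interchange _ _ _ _ ⟩
    (F w + sumOver L F) + (G w + sumOver L G)   ∎

  sumOver-δ : ∀ {L u} (F : Word → 𝕂) → DecUnique.Unique _≟W_ L → u ∈ L → sumOver L (λ w → δ u w * F w) ≈ F u
  sumOver-δ {v ∷ L} {u} F (v∉L ∷ L!) (here ≡.refl) with u ≟W u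
  ... | no u≢u = contradiction ≡.refl u≢u
  ... | yes _  = trans (+-cong (*-identityˡ (F u)) (vanish L v∉L)) (+-identityʳ (F u))
    where
    vanish : ∀ L → All (u ≢_) L → sumOver L (λ w → δ u w * F w) ≈ 0#
    vanish []      []             = refl
    vanish (w ∷ L) (u≢w ∷ u∉L) with u ≟W w
    ... | yes u≡w = contradiction u≡w u≢w
    ... | no  _   = trans (+-cong (zeroˡ (F w)) (vanish L u∉L)) (+-identityˡ 0#)
  sumOver-δ {v ∷ L} {u} F (v∉L ∷ L!) (there u∈L) with u ≟W v
  ... | yes ≡.refl = contradiction ≡.refl (All.lookup v∉L u∈L)
  ... | no  _      = trans (+-cong (zeroˡ (F v)) (sumOver-δ F L! u∈L)) (+-identityˡ _)

  eval-as-sum : ∀ {L} h f → DecUnique.Unique _≟W_ L → (∀ {u} → u ∈ map proj₂ f → u ∈ L) →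
                eval h f ≈ sumOver L (λ w → coeff f w * h w)
  eval-as-sum {L} h [] L! f⊆L = sym (trans (sumOver-cong L λ w → zeroˡ (h w)) (zero-sum L))
    where
    zero-sum : ∀ L → sumOver L (λ _ → 0#) ≈ 0#
    zero-sum []      = refl
    zero-sum (w ∷ L) = trans (+-identityˡ _) (zero-sum L)
  eval-as-sum {L} h ((k , u) ∷ f) L! f⊆L = begin
    k * h u + eval h f
      ≈⟨ +-cong (sym (sumOver-δ (λ w → k * h w) L! (f⊆L (here ≡.refl)))) (eval-as-sum h f L! (f⊆L ∘ there)) ⟩
    sumOver L (λ w → δ u w * (k * h w)) + sumOver L (λ w → coeff f w * h w)
      ≈⟨ sumOver-+ L _ _ ⟨
    sumOver L (λ w → δ u w * (k * h w) + coeff f w * h w)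
      ≈⟨ sumOver-cong L (λ w → trans (+-cong (sym (*-assoc _ k (h w))) refl) (sym (distribʳ (h w) _ _))) ⟩
    sumOver L (λ w → (δ u w * k + coeff f w) * h w)
      ≈⟨ sumOver-cong L (λ w → *-cong (coeff-cons k u f w) refl) ⟨
    sumOver L (λ w → coeff ((k , u) ∷ f) w * h w)
      ∎

  ≈ₚ⇒≃ : ∀ {f g} → f ≈ₚ g → f ≃ g
  ≈ₚ⇒≃ {f} {g} f≈g = mk≃ λ h → begin
    eval h f                           ≈⟨ eval-as-sum h f L! (∈-deduplicate⁺ _≟W_ ∘ ∈-++⁺ˡ) ⟩
    sumOver L (λ w → coeff f w * h w)  ≈⟨ sumOver-cong L (λ w → *-cong (f≈g w) refl) ⟩
    sumOver L (λ w → coeff g w * h w)  ≈⟨ eval-as-sum h g L! (∈-deduplicate⁺ _≟W_ ∘ ∈-++⁺ʳ (map proj₂ f)) ⟨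
    eval h g                           ∎
    where
    L : List Word
    L = deduplicate _≟W_ (map proj₂ f ++ map proj₂ g)
    L! : DecUnique.Unique _≟W_ L
    L! = DecUnique.deduplicate-! _≟W_ (map proj₂ f ++ map proj₂ g)

  •ₚ-cong : ∀ x {f f′} → f ≃ f′ → x •ₚ f ≃ x •ₚ f′
  •ₚ-cong x {f} {f′} f≃f′ = mk≃ λ h → begin
    eval h (x •ₚ f)     ≈⟨ eval-• h x f ⟩
    x * eval h f        ≈⟨ *-cong refl (eval-≈ f≃f′ h) ⟩
    x * eval h f′       ≈⟨ eval-• h x f′ ⟨
    eval h (x •ₚ f′)    ∎

module WeightedProduct {c ℓ a} (K : Field c ℓ) (M : FiniteMonoid a) where
  open FiniteMonoid M using (_⋆_) renaming (Carrier to Mon)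
  open Polynomials K M
  open PolynomialAlgebra K M
  open import Data.Nat using (ℕ; suc; _+_; _<_; s≤s; z≤n)
  open import Relation.Binary.Reasoning.Setoid ≃-setoid
  private
    module ≃ = IsEquivalence ≃-isEquivalence

  weightedProduct : ∀ {l} → (ℕ → Mon) → Vec Poly l → Poly
  weightedProduct C []       = one
  weightedProduct C (f ∷ fs) = (C 0 *ₚ f) ·ₚ weightedProduct (C ∘ suc) fs

  weightedProduct-cong : ∀ {l} {C D : ℕ → Mon} (fs : Vec Poly l) → (∀ t → t < l → C t ≡ D t) →
                         weightedProduct C fs ≡ weightedProduct D fs
  weightedProduct-cong []       C≗D = ≡.refl
  weightedProduct-cong (f ∷ fs) C≗D = ≡.cong₂ (λ x g → (x *ₚ f) ·ₚ g) (C≗D 0 (s≤s z≤n))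
    (weightedProduct-cong fs λ t t<l → C≗D (suc t) (s≤s t<l))

  weightedProduct-++ : ∀ {i l} C (xs : Vec Poly i) (ys : Vec Poly l) →
    weightedProduct C (xs ++ᵥ ys) ≃ weightedProduct C xs ·ₚ weightedProduct (λ t → C (i + t)) ys
  weightedProduct-++ C []       ys = ≃.sym (·ₚ-identityˡ (weightedProduct C ys))
  weightedProduct-++ {suc i} C (x ∷ xs) ys = ≃.trans (·ₚ-congˡ (C 0 *ₚ x) (weightedProduct-++ (C ∘ suc) xs ys))
    (≃.sym (·ₚ-assoc (C 0 *ₚ x) (weightedProduct (C ∘ suc) xs) (weightedProduct (λ t → C (suc (i + t))) ys)))

  weightedProduct-*ₚ : ∀ {l} x C (fs : Vec Poly l) → weightedProduct (λ t → x ⋆ C t) fs ≃ x *ₚ weightedProduct C fs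
  weightedProduct-*ₚ x C []       = ≃.refl
  weightedProduct-*ₚ x C (f ∷ fs) = begin
    ((x ⋆ C 0) *ₚ f) ·ₚ weightedProduct (λ t → x ⋆ C (suc t)) fs
      ≈⟨ ·ₚ-cong (≃.sym (*ₚ-*ₚ x (C 0) f)) (weightedProduct-*ₚ x (C ∘ suc) fs) ⟩
    (x *ₚ (C 0 *ₚ f)) ·ₚ (x *ₚ weightedProduct (C ∘ suc) fs)
      ≈⟨ *ₚ-·ₚ x (C 0 *ₚ f) (weightedProduct (C ∘ suc) fs) ⟨
    x *ₚ ((C 0 *ₚ f) ·ₚ weightedProduct (C ∘ suc) fs)
      ∎

  module _ {i k : ℕ} (C : ℕ → Mon) (xs : Vec Poly i) (zs : Vec Poly k) where
    private
      L R : Poly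
      L = weightedProduct C xs
      R = weightedProduct (λ t → C (i + suc t)) zs

      around : Poly → Poly
      around f = L ·ₚ ((C (i + 0) *ₚ f) ·ₚ R)

      split : ∀ f → weightedProduct C (xs ++ᵥ (f ∷ zs)) ≃ around f
      split f = weightedProduct-++ C xs (f ∷ zs)

    weightedProduct-cong-at : ∀ {f g} → f ≃ g → weightedProduct C (xs ++ᵥ (f ∷ zs)) ≃ weightedProduct C (xs ++ᵥ (g ∷ zs))
    weightedProduct-cong-at {f} {g} f≃g = begin
      weightedProduct C (xs ++ᵥ (f ∷ zs))  ≈⟨ split f ⟩
      around f                             ≈⟨ ·ₚ-congˡ L (·ₚ-congʳ R (*ₚ-cong (C (i + 0)) f≃g)) ⟩
      around g                             ≈⟨ split g ⟨
      weightedProduct C (xs ++ᵥ (g ∷ zs))  ∎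

    weightedProduct-additive : ∀ f g → weightedProduct C (xs ++ᵥ ((f +ₚ g) ∷ zs)) ≃
      weightedProduct C (xs ++ᵥ (f ∷ zs)) +ₚ weightedProduct C (xs ++ᵥ (g ∷ zs))
    weightedProduct-additive f g = begin
      weightedProduct C (xs ++ᵥ ((f +ₚ g) ∷ zs))
        ≈⟨ split (f +ₚ g) ⟩
      L ·ₚ ((C (i + 0) *ₚ (f +ₚ g)) ·ₚ R)
        ≡⟨ ≡.cong (λ h → L ·ₚ (h ·ₚ R)) (*ₚ-+ₚ (C (i + 0)) f g) ⟩
      L ·ₚ (((C (i + 0) *ₚ f) +ₚ (C (i + 0) *ₚ g)) ·ₚ R)
        ≈⟨ ·ₚ-congˡ L (·ₚ-distribʳ-+ₚ (C (i + 0) *ₚ f) (C (i + 0) *ₚ g) R) ⟩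
      L ·ₚ (((C (i + 0) *ₚ f) ·ₚ R) +ₚ ((C (i + 0) *ₚ g) ·ₚ R))
        ≈⟨ ·ₚ-distribˡ-+ₚ L ((C (i + 0) *ₚ f) ·ₚ R) ((C (i + 0) *ₚ g) ·ₚ R) ⟩
      around f +ₚ around g
        ≈⟨ +ₚ-cong (split f) (split g) ⟨
      weightedProduct C (xs ++ᵥ (f ∷ zs)) +ₚ weightedProduct C (xs ++ᵥ (g ∷ zs))
        ∎

    weightedProduct-homogeneous : ∀ y f → weightedProduct C (xs ++ᵥ ((y •ₚ f) ∷ zs)) ≃
      y •ₚ weightedProduct C (xs ++ᵥ (f ∷ zs))
    weightedProduct-homogeneous y f = begin
      weightedProduct C (xs ++ᵥ ((y •ₚ f) ∷ zs))
        ≈⟨ split (y •ₚ f) ⟩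
      L ·ₚ ((C (i + 0) *ₚ (y •ₚ f)) ·ₚ R)
        ≡⟨ ≡.cong (λ h → L ·ₚ (h ·ₚ R)) (*ₚ-•ₚ (C (i + 0)) y f) ⟩
      L ·ₚ ((y •ₚ (C (i + 0) *ₚ f)) ·ₚ R)
        ≈⟨ ·ₚ-congˡ L (·ₚ-•ₚˡ y (C (i + 0) *ₚ f) R) ⟩
      L ·ₚ (y •ₚ ((C (i + 0) *ₚ f) ·ₚ R))
        ≈⟨ ·ₚ-•ₚʳ y L ((C (i + 0) *ₚ f) ·ₚ R) ⟩
      y •ₚ around f
        ≈⟨ •ₚ-cong y (split f) ⟨
      y •ₚ weightedProduct C (xs ++ᵥ (f ∷ zs))
        ∎

module Construction {c ℓ a} (K : Field c ℓ) (M : FiniteMonoid a) where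
  open FiniteMonoid M renaming (Carrier to Mon)
  open Cliques M
  open Polynomials K M
  open NCAlgebra K M
  open PolynomialAlgebra K M
  open WeightedProduct K M
  open CliqueWeights M
  import Data.List as List
  open import Data.Nat using (ℕ; zero; suc; _+_; _<_; s≤s; z<s)
  open import Data.Nat.Properties using (+-suc; +-identityʳ; m<m+n)
  open import Data.Nat.Tactic.RingSolver using (solve)
  open import Relation.Binary.Reasoning.Setoid ≃-setoid
  private
    module ≃ = IsEquivalence ≃-isEquivalence

  act : Action
  act n p _ = weightedProduct (λ t → weight p n (suc t))

  act-unit : ∀ p (hp : IsNCClique 1 p) f → act 1 p hp (f ∷ []) ≃ f
  act-unit p (_ , p₁₂≡𝟙 , _) f = begin
    (weight p 1 1 *ₚ f) ·ₚ one   ≈⟨ ·ₚ-identityʳ _ ⟩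
    weight p 1 1 *ₚ f            ≡⟨ ≡.cong (_*ₚ f) (≡.trans (weight-1-1 p) (p₁₂≡𝟙 ≡.refl)) ⟩
    𝟙 *ₚ f                       ≈⟨ *ₚ-identityˡ f ⟩
    f                            ∎

  act-compose : ∀ i k m p q (hp : IsNCClique (i + suc k) p) (hq : IsNCClique m q)
    (hpq : IsNCClique (i + (m + k)) (compose i m p q)) (xs : Vec Poly i) (ys : Vec Poly m) (zs : Vec Poly k) →
    act (i + (m + k)) (compose i m p q) hpq (xs ++ᵥ (ys ++ᵥ zs)) ≃ act (i + suc k) p hp (xs ++ᵥ (act m q hq ys ∷ zs))
  act-compose i k zero     p q hp (() , _) hpq xs ys zs
  act-compose i k (suc m′) p q hp hq hpq xs ys zs = begin
    weightedProduct ωr (xs ++ᵥ (ys ++ᵥ zs))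
      ≈⟨ weightedProduct-++ ωr xs (ys ++ᵥ zs) ⟩
    weightedProduct ωr xs ·ₚ weightedProduct (λ t → ωr (i + t)) (ys ++ᵥ zs)
      ≈⟨ ·ₚ-congˡ (weightedProduct ωr xs) (weightedProduct-++ (λ t → ωr (i + t)) ys zs) ⟩
    weightedProduct ωr xs ·ₚ (weightedProduct (λ t → ωr (i + t)) ys ·ₚ weightedProduct (λ t → ωr (i + (suc m′ + t))) zs)
      ≡⟨ ≡.cong₂ _·ₚ_ (weightedProduct-cong xs left)
                      (≡.cong₂ _·ₚ_ (weightedProduct-cong ys middle) (weightedProduct-cong zs right)) ⟩
    weightedProduct ωp xs ·ₚ (weightedProduct (λ t → ωp (i + 0) ⋆ ωq t) ys ·ₚ weightedProduct (λ t → ωp (i + suc t)) zs)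
      ≈⟨ ·ₚ-congˡ (weightedProduct ωp xs) (·ₚ-congʳ _ (weightedProduct-*ₚ (ωp (i + 0)) ωq ys)) ⟩
    weightedProduct ωp xs ·ₚ ((ωp (i + 0) *ₚ weightedProduct ωq ys) ·ₚ weightedProduct (λ t → ωp (i + suc t)) zs)
      ≈⟨ weightedProduct-++ ωp xs (weightedProduct ωq ys ∷ zs) ⟨
    weightedProduct ωp (xs ++ᵥ (weightedProduct ωq ys ∷ zs))
      ∎
    where
    open Composition i m′ k p q
    ωr ωp ωq : ℕ → Mon
    ωr t = weight (compose i (suc m′) p q) (i + (suc m′ + k)) (suc t)
    ωp t = weight p (i + suc k) (suc t)
    ωq t = weight q (suc m′) (suc t)

    left : ∀ t → t < i → ωr t ≡ ωp t
    left t t<i = weight-compose-left (s≤s t<i)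

    middle : ∀ t → t < suc m′ → ωr (i + t) ≡ ωp (i + 0) ⋆ ωq t
    middle t t<m = ≡.trans (≡.cong (weight (compose i (suc m′) p q) (i + (suc m′ + k))) (≡.sym (+-suc i t)))
      (≡.trans (weight-compose-middle z<s t<m) (≡.cong (λ j → weight p (i + suc k) (suc j) ⋆ ωq t) (≡.sym (+-identityʳ i))))

    right : ∀ t → t < k → ωr (i + (suc m′ + t)) ≡ ωp (i + suc t)
    right t _ = ≡.trans (≡.cong (weight (compose i (suc m′) p q) (i + (suc m′ + k))) shift)
      (weight-compose-right (s≤s (m<m+n i z<s)))
      where
      shift : suc (i + (suc m′ + t)) ≡ m′ + suc (i + suc t)
      shift = solve (i List.∷ m′ List.∷ t List.∷ List.[])

  isNCMAlgebra : IsNCMAlgebra act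
  isNCMAlgebra = record
    { act-cong-clique = λ n p q _ _ p≋q fs →
        ≃⇒≈ₚ (≃.reflexive (weightedProduct-cong fs λ t _ → weight-cong p≋q (suc t)))
    ; act-cong        = λ i k p _ xs zs f g f≈g → ≃⇒≈ₚ (weightedProduct-cong-at _ xs zs (≈ₚ⇒≃ f≈g))
    ; act-additive    = λ i k p _ xs zs f g → ≃⇒≈ₚ (weightedProduct-additive _ xs zs f g)
    ; act-homogeneous = λ i k p _ xs zs y f → ≃⇒≈ₚ (weightedProduct-homogeneous _ xs zs y f)
    ; act-unit        = λ p hp f → ≃⇒≈ₚ (act-unit p hp f)
    ; act-compose     = λ i k m p q hp hq hpq xs ys zs → ≃⇒≈ₚ (act-compose i k m p q hp hq hpq xs ys zs)
    }

  act-triangle : ∀ p₀ p₁ p₂ (h : IsNCClique 2 (triangle p₀ p₁ p₂)) f₁ f₂ →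
                 act 2 (triangle p₀ p₁ p₂) h (f₁ ∷ f₂ ∷ []) ≃ triangleOp p₀ p₁ p₂ f₁ f₂
  act-triangle p₀ p₁ p₂ _ f₁ f₂ = begin
    (ω₁ *ₚ f₁) ·ₚ ((ω₂ *ₚ f₂) ·ₚ one)          ≈⟨ ·ₚ-congˡ (ω₁ *ₚ f₁) (·ₚ-identityʳ (ω₂ *ₚ f₂)) ⟩
    (ω₁ *ₚ f₁) ·ₚ (ω₂ *ₚ f₂)                   ≡⟨ ≡.cong₂ (λ x y → (x *ₚ f₁) ·ₚ (y *ₚ f₂)) (weight-2-1 tri) (weight-2-2 tri) ⟩
    ((p₀ ⋆ p₁) *ₚ f₁) ·ₚ ((p₀ ⋆ p₂) *ₚ f₂)     ≈⟨ ·ₚ-cong (*ₚ-*ₚ p₀ p₁ f₁) (*ₚ-*ₚ p₀ p₂ f₂) ⟨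
    (p₀ *ₚ (p₁ *ₚ f₁)) ·ₚ (p₀ *ₚ (p₂ *ₚ f₂))   ≈⟨ *ₚ-·ₚ p₀ (p₁ *ₚ f₁) (p₂ *ₚ f₂) ⟨
    p₀ *ₚ ((p₁ *ₚ f₁) ·ₚ (p₂ *ₚ f₂))           ∎
    where
    tri : Clique
    tri = triangle p₀ p₁ p₂
    ω₁ ω₂ : Mon
    ω₁ = weight tri 2 1
    ω₂ = weight tri 2 2

proposition3p20 : ∀ {c ℓ a : Level} (K : Field c ℓ) → CharacteristicZero K →
    (M : FiniteMonoid a) →
    let open FiniteMonoid M
        open Cliques M
        open Polynomials K M
        open NCAlgebra K M
    in Σ Action (λ act → IsNCMAlgebra act ×
         (∀ p₀ p₁ p₂ (h : IsNCClique 2 (triangle p₀ p₁ p₂)) (f₁ f₂ : Poly) →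
            act 2 (triangle p₀ p₁ p₂) h (f₁ ∷ f₂ ∷ []) ≈ₚ triangleOp p₀ p₁ p₂ f₁ f₂))
proposition3p20 K _ M = act , isNCMAlgebra , λ p₀ p₁ p₂ h f₁ f₂ → ≃⇒≈ₚ (act-triangle p₀ p₁ p₂ h f₁ f₂)
  where
  open Construction K M
  open PolynomialAlgebra K M using (≃⇒≈ₚ)
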